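{- Let $\Sigma=\{\mathtt{a},\mathtt{b}\}$ and $k\in\mathbb{N}_0$. The number of congruence classes of $\sim_k$ on $\Sigma^*$ is $|\Sigma^*/{\sim_k}|=1+\sum_{m=0}^{k-1}c_k^m$, where $c_j^{ -1}\coloneqq1$, $c_j^0\coloneqq 2j+1$, and $c_j^n\coloneqq 2(j-n+1)\,c_{j-1}^{n-1}-2(j-n)\,c_{j-2}^{n-2}$ for $n\geq1$.
   Context: A word $u$ is a scattered factor of $w$ if $u$ is obtained from $w$ by deleting some letters (keeping order). For $k\in\mathbb{N}_0$, $u\sim_k v$ iff $u$ and $v$ have exactly the same scattered factors of length at most $k$ (Simon's congruence). -}

module Defs where

open import Data.Nat using (ℕ; zero; suc; _≤_)
open import Data.Integer using (ℤ; +_; _+_; _-_; _*_)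
open import Data.Fin using (Fin)
open import Data.List using (List; length)
open import Data.List.Relation.Binary.Sublist.Propositional using (_⊆_)
open import Data.Product using (Σ; _×_; ∃)
open import Function.Bundles using (_⇔_)
open import Relation.Binary.PropositionalEquality using (_≡_)

data Letter : Set where
  a b : Letter

Word : Set
Word = List Letter

ScatteredFactor : Word → Word → Set
ScatteredFactor u w = u ⊆ w

_∼[_]_ : Word → ℕ → Word → Set
u ∼[ k ] v = ∀ (x : Word) → length x ≤ k → (ScatteredFactor x u ⇔ ScatteredFactor x v)

-- |Σ*/∼_k| = N : there is a family of N representatives, pairwise
-- non-congruent, and every word is congruent to one of them
-- (i.e. a bijection Fin N ≅ Σ*/∼_k).
NumClasses : ℕ → ℕ → Set
NumClasses k N =
  Σ (Fin N → Word) λ r →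
    (∀ i j → r i ∼[ k ] r j → i ≡ j) × (∀ w → ∃ λ i → w ∼[ k ] r i)

-- c j i  represents  c_j^{i-1}  (shifted upper index so that i = 0 is c_j^{-1}).
c : ℤ → ℕ → ℤ
c j zero = + 1
c j (suc zero) = + 2 * j + + 1
c j (suc (suc i)) =
  (+ 2 * (j - + (suc i) + + 1)) * c (j - + 1) (suc i)
  - (+ 2 * (j - + (suc i))) * c (j - + 2) i

sumTo : ℕ → (ℕ → ℤ) → ℤ
sumTo zero f = + 0
sumTo (suc k) f = sumTo k f + f k

-- A word over {a, b} whose universality index ι (number of arches) is m + 1 factors as
-- x^(e+1) (other x) n with ι n = m; a word with ι = 0 is empty or a power of a letter.
-- The index truncated at k is a ∼ₖ-invariant, and all words with at least k arches are
-- ∼ₖ-congruent.  Hence the ∼ₖ₊₁-classes of index m + 1 are listed by a letter x, a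
-- ∼ₖ-class n of index m and an exponent e < k + 1 - m - [the suffix of n after its
-- first x still has m arches]; larger exponents are absorbed.  The number of n for which
-- the bracket is 1 is (k - m) times the number of ∼ₖ₋₁-classes of index m - 1, which turns
-- the count into the recurrence defining c.
module Submission where

open import Defs

open import Data.Bool using (if_then_else_)
open import Data.Empty using (⊥; ⊥-elim)
open import Data.Fin using (zero; suc)
open import Data.List using (List; []; _∷_; _++_; length; replicate; applyUpTo; concatMap; lookup)
open import Data.List.Membership.Propositional.Properties using (∈-lookup)
open import Data.List.Properties using (++-identityʳ; length-++; length-applyUpTo)
open import Data.List.Relation.Binary.Sublist.Propositional using (_⊆_; []; _∷_; _∷ʳ_; minimum)
open import Data.List.Relation.Binary.Sublist.Propositional.Properties using (∷ˡ⁻)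
open import Data.List.Relation.Unary.All as All using (All; []; _∷_)
import Data.List.Relation.Unary.All.Properties as Allₚ
open import Data.List.Relation.Unary.AllPairs as AllPairs using (AllPairs; []; _∷_)
import Data.List.Relation.Unary.AllPairs.Properties as AllPairsₚ
open import Data.List.Relation.Unary.Any as Any using (Any; here; there)
import Data.List.Relation.Unary.Any.Properties as Anyₚ
open import Data.Maybe using (Maybe; just; nothing)
open import Data.Maybe.Relation.Binary.Pointwise as Pointwise using (Pointwise; just; nothing)
open import Data.Nat
  using (ℕ; zero; suc; _+_; _*_; _∸_; _≤_; _<_; _⊓_; z≤n; s≤s; s≤s⁻¹; z<s; _<?_; _≟_)
open import Data.Nat.Properties
open import Algebra.Properties.CommutativeSemigroup ⊓-commutativeSemigroup
  using () renaming (interchange to ⊓-interchange)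
open import Algebra.Properties.CommutativeSemigroup +-commutativeSemigroup
  using () renaming (interchange to +-interchange)
open import Data.Product using (Σ; _×_; _,_; proj₁; ∃; ∃₂)
open import Data.Sum using (_⊎_; inj₁; inj₂)
open import Function.Bundles using (mk⇔; Equivalence)
open import Relation.Binary.PropositionalEquality
open import Relation.Nullary using (¬_; yes; no; does)
open import Relation.Nullary.Decidable using (dec-true; dec-false)

other : Letter → Letter
other a = b
other b = a

after : Letter → Word → Maybe Word
after z [] = nothing
after a (a ∷ w) = just w
after a (b ∷ w) = after a w
after b (a ∷ w) = after b w
after b (b ∷ w) = just w

after-here : ∀ x w → after x (x ∷ w) ≡ just w
after-here a w = refl
after-here b w = refl

after-skip : ∀ x w → after (other x) (x ∷ w) ≡ after (other x) w
after-skip a w = refl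
after-skip b w = refl

after-skip′ : ∀ x w → after x (other x ∷ w) ≡ after x w
after-skip′ a w = refl
after-skip′ b w = refl

after-replicate : ∀ x e w → after (other x) (replicate e x ++ w) ≡ after (other x) w
after-replicate x zero w = refl
after-replicate x (suc e) w = trans (after-skip x _) (after-replicate x e w)

arch : Letter → ℕ → Word → Word
arch x e n = replicate (suc e) x ++ other x ∷ n

powers : ℕ → Letter → List Word
powers k x = applyUpTo (λ e → replicate (suc e) x) k

after-arch : ∀ x e n → after (other x) (arch x e n) ≡ just n
after-arch x e n = trans (after-replicate x (suc e) (other x ∷ n)) (after-here (other x) n)

after-power : ∀ x e → after (other x) (replicate e x) ≡ nothing
after-power x zero = refl
after-power x (suc e) = trans (after-skip x (replicate e x)) (after-power x e)

after-other-just : ∀ x u {u′} → after (other x) u ≡ just u′ →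
                   ∃ λ e → u ≡ replicate e x ++ other x ∷ u′
after-other-just a (a ∷ u) eq with e , refl ← after-other-just a u eq = suc e , refl
after-other-just a (b ∷ u) refl = 0 , refl
after-other-just b (a ∷ u) refl = 0 , refl
after-other-just b (b ∷ u) eq with e , refl ← after-other-just b u eq = suc e , refl

after-other-nothing : ∀ x u → after (other x) u ≡ nothing → u ≡ replicate (length u) x
after-other-nothing x [] eq = refl
after-other-nothing a (a ∷ u) eq = cong (a ∷_) (after-other-nothing a u eq)
after-other-nothing b (b ∷ u) eq = cong (b ∷_) (after-other-nothing b u eq)

letter-cases : ∀ x z → z ≡ x ⊎ z ≡ other x
letter-cases a a = inj₁ refl
letter-cases a b = inj₂ refl
letter-cases b a = inj₂ refl
letter-cases b b = inj₁ refl

-- Over a binary alphabet the first arch of x ∷ w ends at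
-- the first occurrence of other x; ιAfter y w = ι⁺ (after y w) is unfolded into a mutual
-- definition so that ι is structurally recursive.
mutual
  ι : Word → ℕ
  ι [] = 0
  ι (x ∷ w) = ιAfter (other x) w

  ιAfter : Letter → Word → ℕ
  ιAfter y [] = 0
  ιAfter a (a ∷ w) = suc (ι w)
  ιAfter a (b ∷ w) = ιAfter a w
  ιAfter b (a ∷ w) = ιAfter b w
  ιAfter b (b ∷ w) = suc (ι w)

ι⁺ : Maybe Word → ℕ
ι⁺ nothing = 0
ι⁺ (just u) = suc (ι u)

ιAfter≡ι⁺∘after : ∀ y w → ιAfter y w ≡ ι⁺ (after y w)
ιAfter≡ι⁺∘after y [] = refl
ιAfter≡ι⁺∘after a (a ∷ w) = refl
ιAfter≡ι⁺∘after a (b ∷ w) = ιAfter≡ι⁺∘after a w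
ιAfter≡ι⁺∘after b (a ∷ w) = ιAfter≡ι⁺∘after b w
ιAfter≡ι⁺∘after b (b ∷ w) = refl

ι-∷ : ∀ x w → ι (x ∷ w) ≡ ι⁺ (after (other x) w)
ι-∷ x w = ιAfter≡ι⁺∘after (other x) w

ι-∷′ : ∀ x w → ι (other x ∷ w) ≡ ι⁺ (after x w)
ι-∷′ a w = ι-∷ b w
ι-∷′ b w = ι-∷ a w

ι≤ιAfter≤1+ι : ∀ y w → ι w ≤ ιAfter y w × ιAfter y w ≤ suc (ι w)
ι≤ιAfter≤1+ι y [] = z≤n , z≤n
ι≤ιAfter≤1+ι a (a ∷ w) = let (p , q) = ι≤ιAfter≤1+ι b w in q , s≤s p
ι≤ιAfter≤1+ι a (b ∷ w) = ≤-refl , n≤1+n _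
ι≤ιAfter≤1+ι b (a ∷ w) = ≤-refl , n≤1+n _
ι≤ιAfter≤1+ι b (b ∷ w) = let (p , q) = ι≤ιAfter≤1+ι a w in q , s≤s p

ι-mono-∷ : ∀ x w → ι w ≤ ι (x ∷ w)
ι-mono-∷ x w = proj₁ (ι≤ιAfter≤1+ι (other x) w)

ι-mono-++ : ∀ s t → ι t ≤ ι (s ++ t)
ι-mono-++ [] t = ≤-refl
ι-mono-++ (x ∷ s) t = ≤-trans (ι-mono-++ s t) (ι-mono-∷ x (s ++ t))

ι-after≤ : ∀ z w {u} → after z w ≡ just u → ι u ≤ ι w
ι-after≤ a (a ∷ w) refl = ι-mono-∷ a w
ι-after≤ a (b ∷ w) e = ≤-trans (ι-after≤ a w e) (ι-mono-∷ b w)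
ι-after≤ b (a ∷ w) e = ≤-trans (ι-after≤ b w e) (ι-mono-∷ a w)
ι-after≤ b (b ∷ w) refl = ι-mono-∷ b w

-- An arch ends as soon as both letters have been seen.
ι-after-both : ∀ w {u v} → after a w ≡ just u → after b w ≡ just v → ι w ≡ suc (ι u ⊓ ι v)
ι-after-both (a ∷ w) refl e =
  trans (ι-∷ a w) (trans (cong ι⁺ e) (cong suc (sym (m≥n⇒m⊓n≡n (ι-after≤ b w e)))))
ι-after-both (b ∷ w) e refl =
  trans (ι-∷ b w) (trans (cong ι⁺ e) (cong suc (sym (m≤n⇒m⊓n≡m (ι-after≤ a w e)))))

ι-after-nothing : ∀ z w → after z w ≡ nothing → ι w ≡ 0
ι-after-nothing z [] e = refl
ι-after-nothing a (b ∷ w) e = trans (ι-∷ b w) (cong ι⁺ e)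
ι-after-nothing b (a ∷ w) e = trans (ι-∷ a w) (cong ι⁺ e)

ι≤1+ι-after : ∀ x w {u} → after x w ≡ just u → ι w ≤ suc (ι u)
ι≤1+ι-after a w e with after b w in e′
... | just v = ≤-trans (≤-reflexive (ι-after-both w e e′)) (s≤s (m⊓n≤m _ _))
... | nothing = ≤-trans (≤-reflexive (ι-after-nothing b w e′)) z≤n
ι≤1+ι-after b w e with after a w in e′
... | just v = ≤-trans (≤-reflexive (ι-after-both w e′ e)) (s≤s (m⊓n≤n _ _))
... | nothing = ≤-trans (≤-reflexive (ι-after-nothing a w e′)) z≤n

ι-arch : ∀ x e n → ι (arch x e n) ≡ suc (ι n)
ι-arch x e n = trans (ι-∷ x (replicate e x ++ other x ∷ n))
                     (cong ι⁺ (trans (after-replicate x e (other x ∷ n)) (after-here (other x) n)))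

ι-power : ∀ x e → ι (replicate e x) ≡ 0
ι-power x zero = refl
ι-power x (suc e) = trans (ι-∷ x (replicate e x)) (cong ι⁺ (after-power x e))

universal : ℕ → Word
universal zero = []
universal (suc k) = a ∷ b ∷ universal k

ι-universal : ∀ k → ι (universal k) ≡ k
ι-universal zero = refl
ι-universal (suc k) = cong suc (ι-universal k)

ι≡0⇒power : ∀ w → ι w ≡ 0 → w ≡ [] ⊎ ∃₂ λ x e → w ≡ replicate (suc e) x
ι≡0⇒power [] _ = inj₁ refl
ι≡0⇒power (x ∷ w) ιw≡0 with after (other x) w in ew | trans (sym (ι-∷ x w)) ιw≡0
... | nothing | _ = inj₂ (x , length w , cong (x ∷_) (after-other-nothing x w ew))

ι≡suc⇒arch : ∀ w m → ι w ≡ suc m → ∃₂ λ x e → ∃ λ w′ → w ≡ arch x e w′ × ι w′ ≡ m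
ι≡suc⇒arch (x ∷ w) m ιw≡1+m with after (other x) w in ew | trans (sym (ι-∷ x w)) ιw≡1+m
... | just w′ | ιw′≡m with e , refl ← after-other-just x w ew =
  x , e , w′ , refl , suc-injective ιw′≡m

-- Simon's congruence, recursively

data _≈[_]_ : Word → ℕ → Word → Set where
  ≈-zero : ∀ {w v} → w ≈[ zero ] v
  ≈-suc : ∀ {k w v} → (∀ z → Pointwise _≈[ k ]_ (after z w) (after z v)) → w ≈[ suc k ] v

≈-after : ∀ {k w v} → w ≈[ suc k ] v → ∀ z → Pointwise _≈[ k ]_ (after z w) (after z v)
≈-after (≈-suc w≈v) = w≈v

Pointwise-map : {A : Set} {R S : A → A → Set} → (∀ {u v} → R u v → S u v) →
                ∀ {m n} → Pointwise R m n → Pointwise S m n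
Pointwise-map f (just r) = just (f r)
Pointwise-map f nothing = nothing

≈-refl : ∀ k {w} → w ≈[ k ] w
≈-refl zero = ≈-zero
≈-refl (suc k) = ≈-suc λ z → Pointwise.refl (≈-refl k)

≈-sym : ∀ k {w v} → w ≈[ k ] v → v ≈[ k ] w
≈-sym zero _ = ≈-zero
≈-sym (suc k) (≈-suc w≈v) = ≈-suc λ z → Pointwise.sym (≈-sym k) (w≈v z)

≈-trans : ∀ k {u v w} → u ≈[ k ] v → v ≈[ k ] w → u ≈[ k ] w
≈-trans zero _ _ = ≈-zero
≈-trans (suc k) (≈-suc u≈v) (≈-suc v≈w) = ≈-suc λ z → Pointwise.trans (≈-trans k) (u≈v z) (v≈w z)

≈-weaken : ∀ k {w v} → w ≈[ suc k ] v → w ≈[ k ] v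
≈-weaken zero _ = ≈-zero
≈-weaken (suc k) (≈-suc w≈v) = ≈-suc λ z → Pointwise-map (≈-weaken k) (w≈v z)

≈-after-just : ∀ z {k w v w′ v′} → w ≈[ suc k ] v →
               after z w ≡ just w′ → after z v ≡ just v′ → w′ ≈[ k ] v′
≈-after-just z w≈v ew ev = Pointwise.drop-just (subst₂ (Pointwise _) ew ev (≈-after w≈v z))

_≉[_]_ : Word → ℕ → Word → Set
u ≉[ k ] v = ¬ (u ≈[ k ] v)

∷⊆⇒after : ∀ z u w → (z ∷ u) ⊆ w → ∃ λ w′ → after z w ≡ just w′ × u ⊆ w′
∷⊆⇒after z u (_ ∷ w) (refl ∷ u⊆w) = w , after-here z w , u⊆w
∷⊆⇒after a u (a ∷ w) (_ ∷ʳ p) = w , refl , ∷ˡ⁻ p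
∷⊆⇒after a u (b ∷ w) (_ ∷ʳ p) = ∷⊆⇒after a u w p
∷⊆⇒after b u (a ∷ w) (_ ∷ʳ p) = ∷⊆⇒after b u w p
∷⊆⇒after b u (b ∷ w) (_ ∷ʳ p) = w , refl , ∷ˡ⁻ p

after⇒∷⊆ : ∀ z u w {w′} → after z w ≡ just w′ → u ⊆ w′ → (z ∷ u) ⊆ w
after⇒∷⊆ a u (a ∷ w) refl u⊆w = refl ∷ u⊆w
after⇒∷⊆ a u (b ∷ w) e u⊆w′ = b ∷ʳ after⇒∷⊆ a u w e u⊆w′
after⇒∷⊆ b u (a ∷ w) e u⊆w′ = a ∷ʳ after⇒∷⊆ b u w e u⊆w′
after⇒∷⊆ b u (b ∷ w) refl u⊆w = refl ∷ u⊆w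

≈⇒⊆ : ∀ k {w v} → w ≈[ k ] v → ∀ x → length x ≤ k → x ⊆ w → x ⊆ v
≈⇒⊆ k w≈v [] _ _ = minimum _
≈⇒⊆ (suc k) {w} {v} w≈v (z ∷ x) (s≤s |x|≤k) zx⊆w
  with ∷⊆⇒after z x w zx⊆w
... | w′ , e , x⊆w′ with after z v in e′ | subst (λ m → Pointwise _ m (after z v)) e (≈-after w≈v z)
...   | just _ | just w′≈v′ = after⇒∷⊆ z x v e′ (≈⇒⊆ k w′≈v′ x |x|≤k x⊆w′)

≈⇒∼ : ∀ k {w v} → w ≈[ k ] v → w ∼[ k ] v
≈⇒∼ k w≈v x |x|≤k = mk⇔ (≈⇒⊆ k w≈v x |x|≤k) (≈⇒⊆ k (≈-sym k w≈v) x |x|≤k)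

after-transfer : ∀ z {x w v w′} → after z w ≡ just w′ → ((z ∷ x) ⊆ w → (z ∷ x) ⊆ v) →
                 x ⊆ w′ → ∃ λ v′ → after z v ≡ just v′ × x ⊆ v′
after-transfer z e move x⊆w′ = ∷⊆⇒after z _ _ (move (after⇒∷⊆ z _ _ e x⊆w′))

∼-after : ∀ {k w v} → w ∼[ suc k ] v → ∀ z → Pointwise _∼[ k ]_ (after z w) (after z v)
∼-after {k} {w} {v} w∼v z with after z w in ew | after z v in ev
... | nothing | nothing = nothing
... | just w′ | nothing
  with _ , e , _ ← after-transfer z ew (Equivalence.to (w∼v (z ∷ []) (s≤s z≤n))) (minimum w′)
  with () ← trans (sym ev) e
... | nothing | just v′
  with _ , e , _ ← after-transfer z ev (Equivalence.from (w∼v (z ∷ []) (s≤s z≤n))) (minimum v′)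
  with () ← trans (sym ew) e
... | just w′ | just v′ = just λ x |x|≤k →
  mk⇔ (move ew ev (Equivalence.to (w∼v (z ∷ x) (s≤s |x|≤k))))
      (move ev ew (Equivalence.from (w∼v (z ∷ x) (s≤s |x|≤k))))
  where
  move : ∀ {x s t s′ t′} → after z s ≡ just s′ → after z t ≡ just t′ →
         ((z ∷ x) ⊆ s → (z ∷ x) ⊆ t) → x ⊆ s′ → x ⊆ t′
  move es et f x⊆s′ with _ , e , x⊆t″ ← after-transfer z es f x⊆s′
    with refl ← trans (sym et) e = x⊆t″

∼⇒≈ : ∀ k {w v} → w ∼[ k ] v → w ≈[ k ] v
∼⇒≈ zero _ = ≈-zero
∼⇒≈ (suc k) w∼v = ≈-suc λ z → Pointwise-map (∼⇒≈ k) (∼-after w∼v z)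

⊓-distribʳ-⊓ : ∀ x y k → (x ⊓ y) ⊓ k ≡ (x ⊓ k) ⊓ (y ⊓ k)
⊓-distribʳ-⊓ x y k = trans (cong ((x ⊓ y) ⊓_) (sym (⊓-idem k))) (⊓-interchange x y k k)

ι-missing-both : ∀ z w v → after z w ≡ nothing → after z v ≡ nothing → ι w ≡ ι v
ι-missing-both z w v ew ev = trans (ι-after-nothing z w ew) (sym (ι-after-nothing z v ev))

ι⊓-invariant : ∀ k {w v} → w ≈[ k ] v → ι w ⊓ k ≡ ι v ⊓ k
ι⊓-invariant zero {w} {v} _ = trans (⊓-zeroʳ (ι w)) (sym (⊓-zeroʳ (ι v)))
ι⊓-invariant (suc k) {w} {v} w≈v
  with after a w in eaw | after a v in eav | ≈-after w≈v a
... | nothing | nothing | nothing = cong (_⊓ suc k) (ι-missing-both a w v eaw eav)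
... | just wa | just va | just wa≈va
  with after b w in ebw | after b v in ebv | ≈-after w≈v b
...   | nothing | nothing | nothing = cong (_⊓ suc k) (ι-missing-both b w v ebw ebv)
...   | just wb | just vb | just wb≈vb = begin
  ι w ⊓ suc k                    ≡⟨ cong (_⊓ suc k) (ι-after-both w eaw ebw) ⟩
  suc ((ι wa ⊓ ι wb) ⊓ k)        ≡⟨ cong suc (⊓-distribʳ-⊓ (ι wa) (ι wb) k) ⟩
  suc ((ι wa ⊓ k) ⊓ (ι wb ⊓ k))
    ≡⟨ cong₂ (λ p q → suc (p ⊓ q)) (ι⊓-invariant k wa≈va) (ι⊓-invariant k wb≈vb) ⟩
  suc ((ι va ⊓ k) ⊓ (ι vb ⊓ k))  ≡⟨ cong suc (⊓-distribʳ-⊓ (ι va) (ι vb) k) ⟨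
  suc (ι va ⊓ ι vb) ⊓ suc k      ≡⟨ cong (_⊓ suc k) (ι-after-both v eav ebv) ⟨
  ι v ⊓ suc k                    ∎
  where open ≡-Reasoning

ι-invariant< : ∀ k {w v} → w ≈[ k ] v → ι w < k → ι v ≡ ι w
ι-invariant< k {w} {v} w≈v ιw<k
  with ⊓-sel (ι v) k | trans (sym (ι⊓-invariant k w≈v)) (m≤n⇒m⊓n≡m (<⇒≤ ιw<k))
... | inj₁ ιv⊓k≡ιv | ιv⊓k≡ιw = trans (sym ιv⊓k≡ιv) ιv⊓k≡ιw
... | inj₂ ιv⊓k≡k | ιv⊓k≡ιw = ⊥-elim (<-irrefl (trans (sym ιv⊓k≡ιw) ιv⊓k≡k) ιw<k)

≉-ι : ∀ k {u v} → ι u < k → ι u ≢ ι v → u ≉[ k ] v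
≉-ι k ιu<k ιu≢ιv u≈v = ιu≢ιv (sym (ι-invariant< k u≈v ιu<k))

ι>⇒after : ∀ k u → k < ι u → ∀ z → ∃ λ u′ → after z u ≡ just u′ × k ≤ ι u′
ι>⇒after k u k<ιu z with after a u in ea | after b u in eb
... | nothing | _ = ⊥-elim (n≮0 (subst (k <_) (ι-after-nothing a u ea) k<ιu))
... | just _ | nothing = ⊥-elim (n≮0 (subst (k <_) (ι-after-nothing b u eb) k<ιu))
... | just ua | just ub = pick z
  where
  k≤ιua⊓ιub : k ≤ ι ua ⊓ ι ub
  k≤ιua⊓ιub = s≤s⁻¹ (subst (k <_) (ι-after-both u ea eb) k<ιu)
  pick : ∀ z → ∃ λ u′ → after z u ≡ just u′ × k ≤ ι u′
  pick a = ua , ea , ≤-trans k≤ιua⊓ιub (m⊓n≤m _ _)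
  pick b = ub , eb , ≤-trans k≤ιua⊓ιub (m⊓n≤n _ _)

ι≥⇒≈ : ∀ k {u v} → k ≤ ι u → k ≤ ι v → u ≈[ k ] v
ι≥⇒≈ zero _ _ = ≈-zero
ι≥⇒≈ (suc k) {u} {v} k<ιu k<ιv = ≈-suc λ z → suffixes z
  where
  suffixes : ∀ z → Pointwise _≈[ k ]_ (after z u) (after z v)
  suffixes z with u′ , eu , k≤ιu′ ← ι>⇒after k u k<ιu z
                 | v′ , ev , k≤ιv′ ← ι>⇒after k v k<ιv z
    = subst₂ (Pointwise _) (sym eu) (sym ev) (just (ι≥⇒≈ k k≤ιu′ k≤ιv′))

≈-∷ : ∀ k z {p q} → p ≈[ k ] q → (z ∷ p) ≈[ k ] (z ∷ q)
≈-∷ zero z _ = ≈-zero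
≈-∷ (suc k) z {p} {q} p≈q = ≈-suc (suffixes z)
  where
  suffixes : ∀ z y → Pointwise _≈[ k ]_ (after y (z ∷ p)) (after y (z ∷ q))
  suffixes a a = just (≈-weaken k p≈q)
  suffixes a b = ≈-after p≈q b
  suffixes b a = ≈-after p≈q a
  suffixes b b = just (≈-weaken k p≈q)

≈-∷-∷other : ∀ k x {p q} → p ≈[ k ] q → (x ∷ other x ∷ p) ≈[ suc k ] (x ∷ other x ∷ q)
≈-∷-∷other k x {p} {q} p≈q = ≈-suc (suffixes x)
  where
  suffixes : ∀ x y → Pointwise _≈[ k ]_ (after y (x ∷ other x ∷ p)) (after y (x ∷ other x ∷ q))
  suffixes a a = just (≈-∷ k b p≈q)
  suffixes a b = just p≈q
  suffixes b a = just p≈q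
  suffixes b b = just (≈-∷ k a p≈q)

≈-arch : ∀ k x e {p q} → p ≈[ k ] q → arch x e p ≈[ suc k ] arch x e q
≈-arch k x zero p≈q = ≈-∷-∷other k x p≈q
≈-arch k x (suc e) p≈q = ≈-∷ (suc k) x (≈-arch k x e p≈q)

≈-absorb : ∀ j x e p → j ≤ e + ι⁺ (after x p) →
           (replicate e x ++ p) ≈[ j ] (x ∷ replicate e x ++ p)
≈-absorb zero _ _ _ _ = ≈-zero
≈-absorb (suc j) x e p j<e+ι = ≈-suc λ z → suffixes e j<e+ι z (letter-cases x z)
  where
  suffixes : ∀ e → suc j ≤ e + ι⁺ (after x p) → ∀ z → z ≡ x ⊎ z ≡ other x →
             Pointwise _≈[ j ]_ (after z (replicate e x ++ p)) (after z (x ∷ replicate e x ++ p))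
  suffixes e _ z (inj₂ refl) = subst (Pointwise _ _) (sym (after-skip x _)) (Pointwise.refl (≈-refl j))
  suffixes (suc e) j<e+ι z (inj₁ refl) =
    subst₂ (Pointwise _) (sym (after-here x _)) (sym (after-here x _))
           (just (≈-absorb j x e p (s≤s⁻¹ j<e+ι)))
  suffixes zero j<ι z (inj₁ refl) with after x p in ep
  ... | just u = subst (Pointwise _ _) (sym (after-here x p))
                   (just (ι≥⇒≈ j (s≤s⁻¹ j<ι) (≤-trans (s≤s⁻¹ j<ι) (ι-after≤ x p ep))))

≈-replicate : ∀ j x p {e c} → c ≤ e → j ≤ c + ι⁺ (after x p) →
              (replicate e x ++ p) ≈[ j ] (replicate c x ++ p)
≈-replicate j x p c≤e j≤c+ι with m≤n⇒m<n∨m≡n c≤e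
... | inj₂ refl = ≈-refl j
... | inj₁ (s≤s c≤e′) =
  ≈-trans j (≈-sym j (≈-absorb j x _ p (≤-trans j≤c+ι (+-monoˡ-≤ _ c≤e′))))
            (≈-replicate j x p c≤e′ j≤c+ι)

[]≉∷ : ∀ k x w → [] ≉[ suc k ] (x ∷ w)
[]≉∷ k x w []≈xw with subst (Pointwise _ nothing) (after-here x w) (≈-after []≈xw x)
... | ()

power-a≉power-b : ∀ k e e′ → replicate (suc e) a ≉[ suc k ] replicate (suc e′) b
power-a≉power-b k e e′ s with subst (Pointwise _ (just _)) (after-power b e′) (≈-after s a)
... | ()

powers-distinct : ∀ k x → AllPairs _≉[ suc k ]_ (powers (suc k) x)
powers-distinct k x = AllPairsₚ.applyUpTo⁺₁ (λ e → replicate (suc e) x) (suc k)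
                        (λ e<e′ e′<1+k → distinct e<e′ (s≤s⁻¹ e′<1+k))
  where
  distinct : ∀ {k e e′} → e < e′ → e′ ≤ k → replicate (suc e) x ≉[ suc k ] replicate (suc e′) x
  distinct {suc k} {zero} {suc e′} _ _ x≈x^e′ =
    []≉∷ k x _ (≈-after-just x x≈x^e′ (after-here x []) (after-here x _))
  distinct {suc k} {suc e} {suc e′} (s≤s e<e′) (s≤s e′≤k) x^e≈x^e′ =
    distinct e<e′ e′≤k (≈-after-just x x^e≈x^e′ (after-here x _) (after-here x _))

arch-tails-distinct : ∀ k x e e′ {n₁ n₂} → n₁ ≉[ k ] n₂ → arch x e n₁ ≉[ suc k ] arch x e′ n₂
arch-tails-distinct k x e e′ {n₁} {n₂} n₁≉n₂ s =
  n₁≉n₂ (≈-after-just (other x) s (after-arch x e n₁) (after-arch x e′ n₂))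

arch-a≉arch-b : ∀ k e e′ {n₁ n₂} → ι n₁ < k → ι n₂ ≡ ι n₁ →
                arch a e n₁ ≉[ suc k ] arch b e′ n₂
arch-a≉arch-b k e e′ {n₁} {n₂} ιn₁<k ιn₂≡ιn₁ s = distinct e e′ n₁≈bᵉ′an₂ aᵉbn₁≈n₂
  where
  n₁≈bᵉ′an₂ : n₁ ≈[ k ] (replicate e′ b ++ a ∷ n₂)
  n₁≈bᵉ′an₂ = ≈-after-just b s (after-arch a e n₁) refl
  aᵉbn₁≈n₂ : (replicate e a ++ b ∷ n₁) ≈[ k ] n₂
  aᵉbn₁≈n₂ = ≈-after-just a s refl (after-arch b e′ n₂)
  ι-arch≢ : ∀ x d n → ι n ≡ ι n₁ → ι n₁ ≢ ι (arch x d n)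
  ι-arch≢ x d n ιn≡ιn₁ eq = 1+n≢n (trans (sym (trans (ι-arch x d n) (cong suc ιn≡ιn₁))) (sym eq))
  -- For e > 0 or e′ > 0 one of the two congruences relates indices m and m + 1;
  -- for e = e′ = 0 they combine to n₁ ∼ₖ a ∷ b ∷ n₁.
  distinct : ∀ e e′ → n₁ ≈[ k ] (replicate e′ b ++ a ∷ n₂) →
             (replicate e a ++ b ∷ n₁) ≈[ k ] n₂ → ⊥
  distinct e (suc d) t₁ _ = ≉-ι k ιn₁<k (ι-arch≢ b d n₂ ιn₂≡ιn₁) t₁
  distinct (suc d) zero _ t₂ =
    ≉-ι k (subst (_< k) (sym ιn₂≡ιn₁) ιn₁<k)
          (λ eq → ι-arch≢ a d n₁ refl (trans (sym ιn₂≡ιn₁) eq)) (≈-sym k t₂)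
  distinct zero zero t₁ t₂ =
    ≉-ι k ιn₁<k (λ eq → 1+n≢n (sym eq)) (≈-trans k t₁ (≈-sym k (≈-∷ k a t₂)))

other∷≉arch : ∀ L x n d → ι⁺ (after x n) < L → (other x ∷ n) ≉[ L ] arch x d n
other∷≉arch (suc L) x n d ι⁺<1+L s
  with after x n in e | subst₂ (Pointwise _) (after-skip′ x n) (after-here x _) (≈-after s x)
... | just u | just u≈v = ≉-ι L (s≤s⁻¹ ι⁺<1+L) (<⇒≢ ιu<ιv) u≈v
  where
  ιu<ιv : ι u < ι (replicate d x ++ other x ∷ n)
  ιu<ιv = ≤-trans (≤-reflexive (trans (sym (cong ι⁺ e)) (sym (ι-∷′ x n))))
                  (ι-mono-++ (replicate d x) (other x ∷ n))

arch-exponents-distinct : ∀ k x n {e e′} → e < e′ → e′ + ι⁺ (after x n) ≤ k →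
                          arch x e n ≉[ suc k ] arch x e′ n
arch-exponents-distinct k x n {zero} {suc d} _ 1+d+ι⁺≤k s =
  other∷≉arch k x n d (≤-trans (s≤s (m≤n+m _ d)) 1+d+ι⁺≤k)
              (≈-after-just x s (after-here x _) (after-here x _))
arch-exponents-distinct (suc k) x n {suc e} {suc e′} (s≤s e<e′) (s≤s e′+ι⁺≤k) s =
  arch-exponents-distinct k x n e<e′ e′+ι⁺≤k (≈-after-just x s (after-here x _) (after-here x _))

-- Representatives

-- For ι n < k, the words arch x e n with e < exponents k (after x n) are pairwise
-- ∼ₖ₊₁-distinct, and every larger exponent is ∼ₖ₊₁-congruent to the largest of them.
exponents : ℕ → Maybe Word → ℕ
exponents k nothing = suc k
exponents k (just u) = k ∸ ι u

arches : ℕ → Letter → Word → List Word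
arches k x n = applyUpTo (λ e → arch x e n) (exponents k (after x n))

-- representatives of the ∼ₖ-classes of the words with exactly m arches (m < k)
classes : ℕ → ℕ → List Word
classes k zero = [] ∷ powers k a ++ powers k b
classes zero (suc m) = []
classes (suc k) (suc m) = concatMap (arches k a) (classes k m) ++ concatMap (arches k b) (classes k m)

classesBelow : ℕ → ℕ → List Word
classesBelow k zero = []
classesBelow k (suc m) = classesBelow k m ++ classes k m

representatives : ℕ → List Word
representatives k = universal k ∷ classesBelow k k

exponents-pos : ∀ k x n → ι n < k → 0 < exponents k (after x n)
exponents-pos k x n ιn<k with after x n in e
... | nothing = z<s
... | just u = m<n⇒0<n∸m (≤-<-trans (ι-after≤ x n e) ιn<k)

exponents-saturate : ∀ k x n → ι n < k → exponents k (after x n) + ι⁺ (after x n) ≡ suc k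
exponents-saturate k x n ιn<k with after x n in e
... | nothing = +-identityʳ (suc k)
... | just u =
  trans (+-suc (k ∸ ι u) (ι u)) (cong suc (m∸n+n≡m (<⇒≤ (≤-<-trans (ι-after≤ x n e) ιn<k))))

powers-complete : ∀ k x e → Any (replicate (suc e) x ≈[ suc k ]_) (powers (suc k) x)
powers-complete k x e with e <? suc k
... | yes e<1+k = Anyₚ.applyUpTo⁺ (λ e → replicate (suc e) x) (≈-refl (suc k) {replicate (suc e) x}) e<1+k
... | no e≮1+k = Anyₚ.applyUpTo⁺ (λ e → replicate (suc e) x) x^e≈x^k (n<1+n k)
  where
  x^e≈x^k : replicate (suc e) x ≈[ suc k ] replicate (suc k) x
  x^e≈x^k = subst₂ _≈[ suc k ]_ (++-identityʳ (replicate (suc e) x)) (++-identityʳ (replicate (suc k) x))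
              (≈-replicate (suc k) x [] (≰⇒≥ e≮1+k) (≤-reflexive (sym (+-identityʳ (suc k)))))

arches-complete : ∀ k x e {w n} → w ≈[ k ] n → ι n < k → Any (arch x e w ≈[ suc k ]_) (arches k x n)
arches-complete k x e {w} {n} w≈n ιn<k with e <? exponents k (after x n)
... | yes e<D = Anyₚ.applyUpTo⁺ (λ e → arch x e n) (≈-arch k x e w≈n) e<D
... | no e≮D with exponents k (after x n) | exponents-pos k x n ιn<k | exponents-saturate k x n ιn<k
...   | suc c | _ | D+ι≡1+k = Anyₚ.applyUpTo⁺ (λ e → arch x e n) arch-e≈arch-c (n<1+n c)
  where
  arch-large-exponent : arch x e n ≈[ suc k ] arch x c n
  arch-large-exponent = ≈-replicate (suc k) x (other x ∷ n) (s≤s (≤-trans (n≤1+n c) (≮⇒≥ e≮D)))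
    (≤-reflexive (trans (sym D+ι≡1+k) (cong (suc c +_) (cong ι⁺ (sym (after-skip′ x n))))))
  arch-e≈arch-c : arch x e w ≈[ suc k ] arch x c n
  arch-e≈arch-c = ≈-trans (suc k) {arch x e w} {arch x e n} (≈-arch k x e w≈n) arch-large-exponent

classes-suc⁺ : ∀ {P : Word → Set} k m x →
               Any P (concatMap (arches k x) (classes k m)) → Any P (classes (suc k) (suc m))
classes-suc⁺ k m a = Anyₚ.++⁺ˡ
classes-suc⁺ k m b = Anyₚ.++⁺ʳ (concatMap (arches k a) (classes k m))

classes-complete : ∀ k m w → ι w ≡ m → m < k → Any (w ≈[ k ]_) (classes k m)
classes-complete (suc k) zero w ιw≡0 _ with ι≡0⇒power w ιw≡0
... | inj₁ refl = here (≈-refl (suc k) {[]})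
... | inj₂ (a , e , refl) = there (Anyₚ.++⁺ˡ (powers-complete k a e))
... | inj₂ (b , e , refl) = there (Anyₚ.++⁺ʳ (powers (suc k) a) (powers-complete k b e))
classes-complete (suc k) (suc m) w ιw≡1+m (s≤s m<k) with ι≡suc⇒arch w m ιw≡1+m
... | x , e , w′ , refl , ιw′≡m =
  classes-suc⁺ k m x
    (Anyₚ.concatMap⁺ (arches k x) (Any.map arches-complete′ (classes-complete k m w′ ιw′≡m m<k)))
  where
  ιw′<k : ι w′ < k
  ιw′<k = subst (_< k) (sym ιw′≡m) m<k
  arches-complete′ : ∀ {n} → w′ ≈[ k ] n → Any (arch x e w′ ≈[ suc k ]_) (arches k x n)
  arches-complete′ w′≈n =
    arches-complete k x e w′≈n (subst (_< k) (sym (ι-invariant< k w′≈n ιw′<k)) ιw′<k)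

classesBelow⁺ : ∀ {P : Word → Set} k {m n} → m < n → Any P (classes k m) → Any P (classesBelow k n)
classesBelow⁺ k {m} {suc n} m<1+n p with m ≟ n
... | yes refl = Anyₚ.++⁺ʳ (classesBelow k n) p
... | no m≢n = Anyₚ.++⁺ˡ (classesBelow⁺ k (≤∧≢⇒< (s≤s⁻¹ m<1+n) m≢n) p)

representatives-complete : ∀ k w → Any (w ≈[ k ]_) (representatives k)
representatives-complete k w with ι w <? k
... | yes ιw<k = there (classesBelow⁺ k ιw<k (classes-complete k (ι w) w refl ιw<k))
... | no ιw≮k = here (ι≥⇒≈ k (≮⇒≥ ιw≮k) (≤-reflexive (sym (ι-universal k))))

arches-All : ∀ {P Q : Word → Set} k x ns → All Q ns → (∀ e {n} → Q n → P (arch x e n)) →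
             All P (concatMap (arches k x) ns)
arches-All k x ns Qns P-arch =
  Allₚ.concat⁺ (Allₚ.map⁺ (All.map (λ {n} Qn → Allₚ.applyUpTo⁺₂ (λ e → arch x e n) _ (λ e → P-arch e Qn))
                                   Qns))

powers-All : ∀ {P : Word → Set} k x → (∀ e → P (replicate (suc e) x)) → All P (powers k x)
powers-All k x P-power = Allₚ.applyUpTo⁺₂ (λ e → replicate (suc e) x) k P-power

classes-ι : ∀ k m → All (λ n → ι n ≡ m) (classes k m)
classes-ι k zero =
  refl ∷ Allₚ.++⁺ (powers-All k a (λ e → ι-power a (suc e))) (powers-All k b (λ e → ι-power b (suc e)))
classes-ι zero (suc m) = []
classes-ι (suc k) (suc m) = Allₚ.++⁺ (ι-arches a) (ι-arches b)
  where
  ι-arches : ∀ x → All (λ n → ι n ≡ suc m) (concatMap (arches k x) (classes k m))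
  ι-arches x = arches-All k x _ (classes-ι k m) (λ e {n} ιn≡m → trans (ι-arch x e n) (cong suc ιn≡m))

classes-distinct : ∀ k m → m < k → AllPairs _≉[ k ]_ (classes k m)
classes-distinct (suc k) zero _ =
  Allₚ.++⁺ (powers-All (suc k) a (λ e → []≉∷ k a (replicate e a)))
           (powers-All (suc k) b (λ e → []≉∷ k b (replicate e b)))
  ∷ AllPairsₚ.++⁺ (powers-distinct k a) (powers-distinct k b)
      (powers-All (suc k) a λ e → powers-All (suc k) b λ e′ → power-a≉power-b k e e′)
classes-distinct (suc k) (suc m) (s≤s m<k) =
  AllPairsₚ.++⁺ (blocks-distinct a) (blocks-distinct b) a-blocks≉b-blocks
  where
  ιn<k : ∀ {n} → ι n ≡ m → ι n < k
  ιn<k ιn≡m = subst (_< k) (sym ιn≡m) m<k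
  within : ∀ x {n} → ι n ≡ m → AllPairs _≉[ suc k ]_ (arches k x n)
  within x {n} ιn≡m = AllPairsₚ.applyUpTo⁺₁ (λ e → arch x e n) _ λ e<e′ e′<D →
    arch-exponents-distinct k x n e<e′
      (s≤s⁻¹ (≤-trans (+-monoˡ-≤ _ e′<D) (≤-reflexive (exponents-saturate k x n (ιn<k {n} ιn≡m)))))
  across : ∀ x {n₁ n₂} → n₁ ≉[ k ] n₂ → All (λ u → All (u ≉[ suc k ]_) (arches k x n₂)) (arches k x n₁)
  across x n₁≉n₂ =
    Allₚ.applyUpTo⁺₂ _ _ λ e → Allₚ.applyUpTo⁺₂ _ _ λ e′ → arch-tails-distinct k x e e′ n₁≉n₂
  blocks-distinct : ∀ x → AllPairs _≉[ suc k ]_ (concatMap (arches k x) (classes k m))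
  blocks-distinct x = AllPairsₚ.concat⁺ (Allₚ.map⁺ (All.map (within x) (classes-ι k m)))
                                       (AllPairsₚ.map⁺ (AllPairs.map (across x) (classes-distinct k m m<k)))
  a-blocks≉b-blocks : All (λ u → All (u ≉[ suc k ]_) (concatMap (arches k b) (classes k m)))
                          (concatMap (arches k a) (classes k m))
  a-blocks≉b-blocks =
    arches-All k a _ (classes-ι k m) λ e {n₁} ιn₁≡m →
    arches-All k b _ (classes-ι k m) λ e′ ιn₂≡m →
    arch-a≉arch-b k e e′ (ιn<k {n₁} ιn₁≡m) (trans ιn₂≡m (sym ιn₁≡m))

classesBelow-ι : ∀ k n → All (λ u → ι u < n) (classesBelow k n)
classesBelow-ι k zero = []
classesBelow-ι k (suc n) = Allₚ.++⁺ (All.map (λ ιu<n → m<n⇒m<1+n ιu<n) (classesBelow-ι k n))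
                                    (All.map (λ ιu≡n → ≤-reflexive (cong suc ιu≡n)) (classes-ι k n))

classesBelow-distinct : ∀ k n → n ≤ k → AllPairs _≉[ k ]_ (classesBelow k n)
classesBelow-distinct k zero _ = []
classesBelow-distinct k (suc n) n<k =
  AllPairsₚ.++⁺ (classesBelow-distinct k n (<⇒≤ n<k)) (classes-distinct k n n<k)
    (All.map (λ ιu<n → All.map (λ ιv≡n → ≉-ι k (<-trans ιu<n n<k) (<⇒≢ (subst (_ <_) (sym ιv≡n) ιu<n)))
                               (classes-ι k n))
             (classesBelow-ι k n))

representatives-distinct : ∀ k → AllPairs _≉[ k ]_ (representatives k)
representatives-distinct k =
  All.map (λ ιu<k univ≈u → ≉-ι k ιu<k (<⇒≢ (subst (_ <_) (sym (ι-universal k)) ιu<k)) (≈-sym k univ≈u))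
          (classesBelow-ι k k)
  ∷ classesBelow-distinct k k ≤-refl

-- Counting

∑ : {A : Set} → List A → (A → ℕ) → ℕ
∑ [] f = 0
∑ (x ∷ xs) f = f x + ∑ xs f

∑-++ : ∀ {A : Set} (xs ys : List A) f → ∑ (xs ++ ys) f ≡ ∑ xs f + ∑ ys f
∑-++ [] ys f = refl
∑-++ (x ∷ xs) ys f = trans (cong (f x +_) (∑-++ xs ys f)) (sym (+-assoc (f x) _ _))

∑-+ : ∀ {A : Set} (xs : List A) f g → ∑ xs (λ x → f x + g x) ≡ ∑ xs f + ∑ xs g
∑-+ [] f g = refl
∑-+ (x ∷ xs) f g = trans (cong (f x + g x +_) (∑-+ xs f g)) (+-interchange (f x) (g x) _ _)

∑-const : ∀ {A : Set} {xs : List A} {f c} → All (λ x → f x ≡ c) xs → ∑ xs f ≡ length xs * c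
∑-const [] = refl
∑-const (fx≡c ∷ fxs≡c) = cong₂ _+_ fx≡c (∑-const fxs≡c)

∑-concatMap : ∀ {A B : Set} (g : A → List B) xs f → ∑ (concatMap g xs) f ≡ ∑ xs (λ x → ∑ (g x) f)
∑-concatMap g [] f = refl
∑-concatMap g (x ∷ xs) f = trans (∑-++ (g x) _ f) (cong (∑ (g x) f +_) (∑-concatMap g xs f))

length-concatMap : ∀ {A B : Set} (g : A → List B) xs → length (concatMap g xs) ≡ ∑ xs (λ x → length (g x))
length-concatMap g [] = refl
length-concatMap g (x ∷ xs) = trans (length-++ (g x)) (cong (length (g x) +_) (length-concatMap g xs))

∑-cong : ∀ {A : Set} (xs : List A) {f g} → (∀ x → f x ≡ g x) → ∑ xs f ≡ ∑ xs g
∑-cong [] f≗g = refl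
∑-cong (x ∷ xs) f≗g = cong₂ _+_ (f≗g x) (∑-cong xs f≗g)

∑-applyUpTo-const : ∀ {A : Set} (h : ℕ → A) n {f c} → (∀ e → f (h e) ≡ c) →
                    ∑ (applyUpTo h n) f ≡ n * c
∑-applyUpTo-const h n f∘h≡c =
  trans (∑-const (Allₚ.applyUpTo⁺₂ h n f∘h≡c)) (cong (_* _) (length-applyUpTo h n))

count : ℕ → ℕ → ℕ
count k m = length (classes k m)

sameIndex : ℕ → Maybe Word → ℕ
sameIndex m nothing = 0
sameIndex m (just u) = if does (ι u ≟ m) then 1 else 0

kept : ℕ → ℕ → Letter → ℕ
kept k m x = ∑ (classes k m) (λ n → sameIndex m (after x n))

sameIndex-just : ∀ {m} u → ι u ≡ m → sameIndex m (just u) ≡ 1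
sameIndex-just {m} u ιu≡m = cong (if_then 1 else 0) (dec-true (ι u ≟ m) ιu≡m)

sameIndex-just≢ : ∀ {m} u → ι u ≢ m → sameIndex m (just u) ≡ 0
sameIndex-just≢ {m} u ιu≢m = cong (if_then 1 else 0) (dec-false (ι u ≟ m) ιu≢m)

sameIndex-∷other : ∀ m x n → sameIndex (suc m) (just (other x ∷ n)) ≡ sameIndex m (after x n)
sameIndex-∷other m x n rewrite ι-∷′ x n with after x n
... | nothing = refl
... | just u = refl

exponents+sameIndex : ∀ k x n {m} → ι n ≡ m → m < k →
                      exponents k (after x n) + sameIndex m (after x n) ≡ suc (k ∸ m)
exponents+sameIndex k x n refl ιn<k with after x n in e
... | nothing rewrite ι-after-nothing x n e = +-identityʳ (suc k)
... | just u with ι u ≟ ι n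
...   | yes ιu≡ιn =
  trans (cong₂ _+_ (cong (k ∸_) ιu≡ιn) (sameIndex-just u ιu≡ιn)) (+-comm (k ∸ ι n) 1)
...   | no ιu≢ιn = begin
  k ∸ ι u + sameIndex (ι n) (just u)  ≡⟨ cong (k ∸ ι u +_) (sameIndex-just≢ u ιu≢ιn) ⟩
  k ∸ ι u + 0                         ≡⟨ +-identityʳ _ ⟩
  k ∸ ι u                             ≡⟨ +-∸-assoc 1 1+ιu≤k ⟩
  suc (k ∸ suc (ι u))                 ≡⟨ cong (λ i → suc (k ∸ i)) ιn≡1+ιu ⟨
  suc (k ∸ ι n)                       ∎
  where
  open ≡-Reasoning
  ιn≡1+ιu : ι n ≡ suc (ι u)
  ιn≡1+ιu = ≤-antisym (ι≤1+ι-after x n e) (≤∧≢⇒< (ι-after≤ x n e) ιu≢ιn)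
  1+ιu≤k : suc (ι u) ≤ k
  1+ιu≤k = subst (_≤ k) ιn≡1+ιu (<⇒≤ ιn<k)

-- Deleting up to the first x from arch x e n keeps its index for e > 0; for e = 0 it
-- does exactly when deleting up to the first x from n keeps the index of n.
∑-arches-self : ∀ k x n {m} → ι n ≡ m → m < k →
                ∑ (arches k x n) (λ u → sameIndex (suc m) (after x u)) ≡ k ∸ m
∑-arches-self k x n refl ιn<k with exponents k (after x n) in eD | exponents-pos k x n ιn<k
... | suc d | _ = begin
  f (arch x 0 n) + ∑ (applyUpTo (λ e → arch x (suc e) n) d) f  ≡⟨ cong₂ _+_ shortest-arch longer-arches ⟩
  sameIndex (ι n) (after x n) + d * 1                         ≡⟨ cong (_ +_) (*-identityʳ d) ⟩
  sameIndex (ι n) (after x n) + d                             ≡⟨ +-comm _ d ⟩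
  d + sameIndex (ι n) (after x n)                             ≡⟨ suc-injective D+sameIndex ⟩
  k ∸ ι n                                                     ∎
  where
  open ≡-Reasoning
  f : Word → ℕ
  f u = sameIndex (suc (ι n)) (after x u)
  shortest-arch : f (arch x 0 n) ≡ sameIndex (ι n) (after x n)
  shortest-arch = trans (cong (sameIndex _) (after-here x _)) (sameIndex-∷other (ι n) x n)
  longer-arches : ∑ (applyUpTo (λ e → arch x (suc e) n) d) f ≡ d * 1
  longer-arches = ∑-applyUpTo-const _ d λ e →
    trans (cong (sameIndex _) (after-here x (arch x e n))) (sameIndex-just (arch x e n) (ι-arch x e n))
  D+sameIndex : suc d + sameIndex (ι n) (after x n) ≡ suc (k ∸ ι n)
  D+sameIndex = trans (cong (_+ _) (sym eD)) (exponents+sameIndex k x n refl ιn<k)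

∑-arches-other : ∀ k x n {m} → ι n ≡ m → ∑ (arches k x n) (λ u → sameIndex (suc m) (after (other x) u)) ≡ 0
∑-arches-other k x n refl =
  trans (∑-applyUpTo-const (λ e → arch x e n) (exponents k (after x n)) index-drops)
        (*-zeroʳ (exponents k (after x n)))
  where
  index-drops : ∀ e → sameIndex (suc (ι n)) (after (other x) (arch x e n)) ≡ 0
  index-drops e = trans (cong (sameIndex _) (after-arch x e n)) (sameIndex-just≢ n (λ eq → 1+n≢n (sym eq)))

∑-classes : ∀ k m {f c} → (∀ n → ι n ≡ m → f n ≡ c) → ∑ (classes k m) f ≡ count k m * c
∑-classes k m f≡c = ∑-const (All.map (λ {n} → f≡c n) (classes-ι k m))

∑-powers-self : ∀ k x → ∑ (powers k x) (λ w → sameIndex 0 (after x w)) ≡ k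
∑-powers-self k x = trans (∑-applyUpTo-const _ k index-0) (*-identityʳ k)
  where
  index-0 : ∀ e → sameIndex 0 (after x (replicate (suc e) x)) ≡ 1
  index-0 e = trans (cong (sameIndex 0) (after-here x _)) (sameIndex-just (replicate e x) (ι-power x e))

∑-powers-other : ∀ k x → ∑ (powers k x) (λ w → sameIndex 0 (after (other x) w)) ≡ 0
∑-powers-other k x = trans (∑-applyUpTo-const _ k λ e → cong (sameIndex 0) (after-power x (suc e))) (*-zeroʳ k)

kept-zero : ∀ k x → kept k 0 x ≡ k
kept-zero k a =
  trans (∑-++ (powers k a) _ _) (trans (cong₂ _+_ (∑-powers-self k a) (∑-powers-other k b)) (+-identityʳ k))
kept-zero k b = trans (∑-++ (powers k a) _ _) (cong₂ _+_ (∑-powers-other k a) (∑-powers-self k b))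

kept-suc : ∀ k m x → m < k → kept (suc k) (suc m) x ≡ count k m * (k ∸ m)
kept-suc k m x m<k = trans (∑-++ (concatMap (arches k a) (classes k m)) _ _) (letters x)
  where
  block : ∀ y {f c} → (∀ n → ι n ≡ m → ∑ (arches k y n) f ≡ c) →
          ∑ (concatMap (arches k y) (classes k m)) f ≡ count k m * c
  block y {f} f≡c = trans (∑-concatMap (arches k y) (classes k m) f) (∑-classes k m f≡c)
  self : ∀ y → ∑ (concatMap (arches k y) (classes k m)) (λ u → sameIndex (suc m) (after y u))
               ≡ count k m * (k ∸ m)
  self y = block y λ n ιn≡m → ∑-arches-self k y n ιn≡m m<k
  other′ : ∀ y → ∑ (concatMap (arches k y) (classes k m)) (λ u → sameIndex (suc m) (after (other y) u)) ≡ 0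
  other′ y = trans (block y λ n ιn≡m → ∑-arches-other k y n ιn≡m) (*-zeroʳ (count k m))
  letters : ∀ x → ∑ (concatMap (arches k a) (classes k m)) (λ u → sameIndex (suc m) (after x u))
                  + ∑ (concatMap (arches k b) (classes k m)) (λ u → sameIndex (suc m) (after x u))
                  ≡ count k m * (k ∸ m)
  letters a = trans (cong₂ _+_ (self a) (other′ b)) (+-identityʳ _)
  letters b = cong₂ _+_ (other′ a) (self b)

count-suc : ∀ k m → count (suc k) (suc m)
                    ≡ ∑ (classes k m) (λ n → exponents k (after a n)) + ∑ (classes k m) (λ n → exponents k (after b n))
count-suc k m = trans (length-++ (concatMap (arches k a) (classes k m))) (cong₂ _+_ (block a) (block b))
  where
  block : ∀ x → length (concatMap (arches k x) (classes k m)) ≡ ∑ (classes k m) (λ n → exponents k (after x n))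
  block x = trans (length-concatMap (arches k x) (classes k m))
                  (∑-cong (classes k m) λ n → length-applyUpTo (λ e → arch x e n) (exponents k (after x n)))

exponents+kept : ∀ k m x → m < k →
                 ∑ (classes k m) (λ n → exponents k (after x n)) + kept k m x ≡ count k m * suc (k ∸ m)
exponents+kept k m x m<k =
  trans (sym (∑-+ (classes k m) _ _)) (∑-classes k m λ n ιn≡m → exponents+sameIndex k x n ιn≡m m<k)

-- previous k m is c_k^(m-1), with c_k^(-1) = 1.
previous : ℕ → ℕ → ℕ
previous k zero = 1
previous k (suc m) = count k m

kept≡previous : ∀ k m x → m < suc k → kept (suc k) m x ≡ previous k m * (suc k ∸ m)
kept≡previous k zero x _ = trans (kept-zero (suc k) x) (sym (*-identityˡ (suc k)))
kept≡previous k (suc m) x (s≤s m<k) = kept-suc k m x m<k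

-- Per letter, a representative of index m admits suc (k ∸ m) exponents, one fewer when
-- the suffix after that letter keeps index m.
count-recurrence : ∀ k m → m < suc k →
  count (suc (suc k)) (suc m) + (previous k m * (suc k ∸ m) + previous k m * (suc k ∸ m))
  ≡ count (suc k) m * suc (suc k ∸ m) + count (suc k) m * suc (suc k ∸ m)
count-recurrence k m m<1+k = begin
  count (suc (suc k)) (suc m) + (previous k m * (suc k ∸ m) + previous k m * (suc k ∸ m))
    ≡⟨ cong (count (suc (suc k)) (suc m) +_) (cong₂ _+_ (kept≡previous k m a m<1+k) (kept≡previous k m b m<1+k)) ⟨
  count (suc (suc k)) (suc m) + (kept (suc k) m a + kept (suc k) m b)
    ≡⟨ cong (_+ (kept (suc k) m a + kept (suc k) m b)) (count-suc (suc k) m) ⟩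
  (exps a + exps b) + (kept (suc k) m a + kept (suc k) m b)
    ≡⟨ +-interchange (exps a) (exps b) _ _ ⟩
  (exps a + kept (suc k) m a) + (exps b + kept (suc k) m b)
    ≡⟨ cong₂ _+_ (exponents+kept (suc k) m a m<1+k) (exponents+kept (suc k) m b m<1+k) ⟩
  count (suc k) m * suc (suc k ∸ m) + count (suc k) m * suc (suc k ∸ m) ∎
  where
  open ≡-Reasoning
  exps : Letter → ℕ
  exps x = ∑ (classes (suc k) m) (λ n → exponents (suc k) (after x n))

count-zero : ∀ k → count k 0 ≡ suc (k + k)
count-zero k = cong suc (trans (length-++ (powers k a)) (cong₂ _+_ (length-applyUpTo _ k) (length-applyUpTo _ k)))

-- The closed form

import Data.Integer as ℤ
open ℤ using (ℤ; +_)
import Data.Integer.Properties as ℤₚ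
open import Data.Integer.Tactic.RingSolver using (solve-∀)

n≡[n+y]-y : ∀ (n y : ℤ) → n ≡ (n ℤ.+ y) ℤ.- y
n≡[n+y]-y = solve-∀

1+[k+k]≡2k+1 : ∀ (k : ℤ) → + 1 ℤ.+ (k ℤ.+ k) ≡ + 2 ℤ.* k ℤ.+ + 1
1+[k+k]≡2k+1 = solve-∀

recurrence-shape : ∀ (c p t : ℤ) →
  (c ℤ.* (+ 1 ℤ.+ t) ℤ.+ c ℤ.* (+ 1 ℤ.+ t)) ℤ.- (p ℤ.* t ℤ.+ p ℤ.* t)
  ≡ (+ 2 ℤ.* (t ℤ.+ + 1)) ℤ.* c ℤ.- (+ 2 ℤ.* t) ℤ.* p
recurrence-shape = solve-∀

recurrence-ℤ : ∀ n p c t → n + (p * t + p * t) ≡ c * suc t + c * suc t →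
               + n ≡ (+ 2 ℤ.* (+ t ℤ.+ + 1)) ℤ.* + c ℤ.- (+ 2 ℤ.* + t) ℤ.* + p
recurrence-ℤ n p c t eq = begin
  + n                                                         ≡⟨ n≡[n+y]-y (+ n) 2pt ⟩
  (+ n ℤ.+ 2pt) ℤ.- 2pt                                       ≡⟨ cong (ℤ._- 2pt) pushed ⟩
  (+ c ℤ.* (+ 1 ℤ.+ + t) ℤ.+ + c ℤ.* (+ 1 ℤ.+ + t)) ℤ.- 2pt   ≡⟨ recurrence-shape (+ c) (+ p) (+ t) ⟩
  (+ 2 ℤ.* (+ t ℤ.+ + 1)) ℤ.* + c ℤ.- (+ 2 ℤ.* + t) ℤ.* + p   ∎
  where
  open ≡-Reasoning
  2pt : ℤ
  2pt = + p ℤ.* + t ℤ.+ + p ℤ.* + t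
  pushed : + n ℤ.+ 2pt ≡ + c ℤ.* (+ 1 ℤ.+ + t) ℤ.+ + c ℤ.* (+ 1 ℤ.+ + t)
  pushed = begin
    + n ℤ.+ 2pt                                 ≡⟨ cong (λ i → + n ℤ.+ i) (cong₂ ℤ._+_ (ℤₚ.pos-* p t) (ℤₚ.pos-* p t)) ⟨
    + n ℤ.+ (+ (p * t) ℤ.+ + (p * t))           ≡⟨ cong (λ i → + n ℤ.+ i) (ℤₚ.pos-+ (p * t) (p * t)) ⟨
    + n ℤ.+ + (p * t + p * t)                   ≡⟨ ℤₚ.pos-+ n _ ⟨
    + (n + (p * t + p * t))                     ≡⟨ cong +_ eq ⟩
    + (c * suc t + c * suc t)                   ≡⟨ ℤₚ.pos-+ (c * suc t) _ ⟩
    + (c * suc t) ℤ.+ + (c * suc t)             ≡⟨ cong₂ ℤ._+_ (ℤₚ.pos-* c (suc t)) (ℤₚ.pos-* c (suc t)) ⟩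
    + c ℤ.* + suc t ℤ.+ + c ℤ.* + suc t         ≡⟨ cong (λ s → + c ℤ.* s ℤ.+ + c ℤ.* s) (ℤₚ.pos-+ 1 t) ⟩
    + c ℤ.* (+ 1 ℤ.+ + t) ℤ.+ + c ℤ.* (+ 1 ℤ.+ + t) ∎

count≡c : ∀ k m → m < k → + count k m ≡ c (+ k) (suc m)
previous≡c : ∀ k m → m < suc k → + previous k m ≡ c (+ k) m

count≡c (suc k) zero _ = begin
  + count (suc k) 0                 ≡⟨ cong +_ (count-zero (suc k)) ⟩
  + (1 + (suc k + suc k))           ≡⟨ ℤₚ.pos-+ 1 _ ⟩
  + 1 ℤ.+ + (suc k + suc k)         ≡⟨ cong (λ i → + 1 ℤ.+ i) (ℤₚ.pos-+ (suc k) (suc k)) ⟩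
  + 1 ℤ.+ (+ suc k ℤ.+ + suc k)     ≡⟨ 1+[k+k]≡2k+1 (+ suc k) ⟩
  + 2 ℤ.* + suc k ℤ.+ + 1           ∎
  where open ≡-Reasoning
count≡c (suc (suc k)) (suc m) (s≤s m<1+k) = begin
  + count (suc (suc k)) (suc m)
    ≡⟨ recurrence-ℤ _ _ _ t (count-recurrence k m m<1+k) ⟩
  (+ 2 ℤ.* (+ t ℤ.+ + 1)) ℤ.* + count (suc k) m ℤ.- (+ 2 ℤ.* + t) ℤ.* + previous k m
    ≡⟨ cong₂ (shape (+ t)) (count≡c (suc k) m m<1+k) (previous≡c k m m<1+k) ⟩
  shape (+ t) (c (+ suc k) (suc m)) (c (+ k) m)
    ≡⟨ cong (λ s → shape s (c (+ suc k) (suc m)) (c (+ k) m)) k+2-[m+1]≡t ⟨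
  c (+ suc (suc k)) (suc (suc m))
    ∎
  where
  open ≡-Reasoning
  shape : ℤ → ℤ → ℤ → ℤ
  shape s C P = (+ 2 ℤ.* (s ℤ.+ + 1)) ℤ.* C ℤ.- (+ 2 ℤ.* s) ℤ.* P
  t : ℕ
  t = suc k ∸ m
  k+2-[m+1]≡t : + suc (suc k) ℤ.- + suc m ≡ + t
  k+2-[m+1]≡t = trans (ℤₚ.[+m]-[+n]≡m⊖n (suc (suc k)) (suc m)) (ℤₚ.⊖-≥ (s≤s (<⇒≤ m<1+k)))

previous≡c k zero _ = refl
previous≡c k (suc m) (s≤s m<k) = count≡c k m m<k

length-classesBelow : ∀ k n → n ≤ k → + length (classesBelow k n) ≡ sumTo n (λ m → c (+ k) (suc m))
length-classesBelow k zero _ = refl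
length-classesBelow k (suc n) n<k =
  trans (cong +_ (length-++ (classesBelow k n)))
        (trans (ℤₚ.pos-+ (length (classesBelow k n)) _)
               (cong₂ ℤ._+_ (length-classesBelow k n (<⇒≤ n<k)) (count≡c k n n<k)))

lookup-injective : ∀ {A : Set} {R : A → A → Set} → (∀ {x y} → R x y → R y x) →
                   ∀ {xs} → AllPairs (λ x y → ¬ R x y) xs →
                   ∀ i j → R (lookup xs i) (lookup xs j) → i ≡ j
lookup-injective R-sym (_ ∷ _) zero zero _ = refl
lookup-injective R-sym (x≁xs ∷ _) zero (suc j) r = ⊥-elim (All.lookup x≁xs (∈-lookup j) r)
lookup-injective R-sym (x≁xs ∷ _) (suc i) zero r = ⊥-elim (All.lookup x≁xs (∈-lookup i) (R-sym r))
lookup-injective R-sym (_ ∷ xs≁) (suc i) (suc j) r = cong suc (lookup-injective R-sym xs≁ i j r)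

corollary2 : (k : ℕ) → Σ ℕ λ N →
    NumClasses k N × (+ N ≡ + 1 ℤ.+ sumTo k (λ m → c (+ k) (suc m)))
corollary2 k = length (representatives k) , (lookup (representatives k) , distinct , complete) , size
  where
  distinct : ∀ i j → lookup (representatives k) i ∼[ k ] lookup (representatives k) j → i ≡ j
  distinct i j ri∼rj = lookup-injective (≈-sym k) (representatives-distinct k) i j (∼⇒≈ k ri∼rj)
  complete : ∀ w → ∃ λ i → w ∼[ k ] lookup (representatives k) i
  complete w = Any.index w≈r , ≈⇒∼ k (Anyₚ.lookup-index w≈r)
    where
    w≈r : Any (w ≈[ k ]_) (representatives k)
    w≈r = representatives-complete k w
  size : + length (representatives k) ≡ + 1 ℤ.+ sumTo k (λ m → c (+ k) (suc m))
  size = trans (ℤₚ.pos-+ 1 _) (cong (λ i → + 1 ℤ.+ i) (length-classesBelow k k ≤-refl))
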